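{- Let $k\ge1$ and let $H_k$ be the vertex-disjoint union of $k$ copies of $K_2$. Then for all $n\ge 2k+1$, the uniform matroid ${\mathcal U}_{k-1}(E(K_n))$ of rank $k-1$ on $E(K_n)$ is the unique maximal $H_k$-matroid on $K_n$ (in the weak order), and ${\rm val}_{H_k}$ is its rank function.
   Context: An $H$-matroid on a graph $G$ is a matroid on $E(G)$ in which the edge set of every subgraph of $G$ isomorphic to $H$ is a circuit. Weak order: ${\mathcal M}_1\preceq{\mathcal M}_2$ if every independent set of ${\mathcal M}_1$ is independent in ${\mathcal M}_2$. Let ${\mathcal X}$ be the family of edge sets of subgraphs of $K_n$ isomorphic to $H$. A proper ${\mathcal X}$-sequence is a sequence $(X_1,\dots,X_m)$ of sets in ${\mathcal X}$ with $X_i\not\subseteq\bigcup_{j<i}X_j$ for $i\ge2$; for $F\subseteq E(K_n)$, ${\rm val}(F,{\mathcal S})=|F\cup\bigcup_iX_i|-m$, and ${\rm val}_H(F)=\min_{\mathcal S}{\rm val}(F,{\mathcal S})$ over all proper ${\mathcal X}$-sequences. -}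

module Defs where

open import Data.Nat using (ℕ; zero; suc; _+_; _*_; _∸_; _≤_; _<_)
open import Data.Fin using (Fin; toℕ) renaming (_<_ to _<ᶠ_; _≟_ to _≟ᶠ_)
open import Data.Fin.Properties using () renaming (_<?_ to _<ᶠ?_)
open import Data.List using (List; []; _∷_; concatMap; map; allFin; length; lookup; take; foldr)
open import Data.Nat.ListAction using (sum)
open import Data.List.Relation.Unary.All using (All)
open import Data.Bool using (Bool; true; false; if_then_else_; _∨_; _∧_; not)
open import Data.Product using (Σ; _×_; _,_; proj₁; proj₂; ∃)
open import Data.Sum using (_⊎_; inj₁; inj₂)
open import Relation.Nullary using (¬_; yes; no; does)
open import Relation.Binary.PropositionalEquality using (_≡_)
open import Function.Definitions using (Injective)
open import Function.Bundles using (_⇔_)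

-- Edges of K_n: pairs (i , j) with i < j.
Edge : ℕ → Set
Edge n = Σ (Fin n × Fin n) (λ p → proj₁ p <ᶠ proj₂ p)

allEdges : (n : ℕ) → List (Edge n)
allEdges n = concatMap (λ i → concatMap (λ j → pick i j) (allFin n)) (allFin n)
  where
  pick : Fin n → Fin n → List (Edge n)
  pick i j with i <ᶠ? j
  ... | yes p = ((i , j) , p) ∷ []
  ... | no _  = []

ESet : ℕ → Set
ESet n = Edge n → Bool

module _ {n : ℕ} where

  _∈ₑ_ : Edge n → ESet n → Set
  e ∈ₑ X = X e ≡ true

  _⊆ₑ_ : ESet n → ESet n → Set
  X ⊆ₑ Y = ∀ e → e ∈ₑ X → e ∈ₑ Y

  ∅ₑ : ESet n
  ∅ₑ _ = false

  _∪ₑ_ : ESet n → ESet n → ESet n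
  (X ∪ₑ Y) e = X e ∨ Y e

  eqE : Edge n → Edge n → Bool
  eqE ((a , b) , _) ((c , d) , _) = does (a ≟ᶠ c) ∧ does (b ≟ᶠ d)

  ⁅_⁆ₑ : Edge n → ESet n
  ⁅ e ⁆ₑ f = eqE f e

  _∖ₑ_ : ESet n → Edge n → ESet n
  (X ∖ₑ e) f = X f ∧ not (eqE f e)

  card : ESet n → ℕ
  card X = sum (map (λ e → if X e then 1 else 0) (allEdges n))

record Matroid (n : ℕ) : Set₁ where
  field
    Indep     : ESet n → Set
    indep-∅   : Indep ∅ₑ
    indep-⊆   : ∀ {X Y} → Y ⊆ₑ X → Indep X → Indep Y
    indep-aug : ∀ {X Y} → Indep X → Indep Y → card X < card Y →
                Σ (Edge n) λ e → e ∈ₑ Y × ¬ (e ∈ₑ X) × Indep (X ∪ₑ ⁅ e ⁆ₑ)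
open Matroid public

module _ {n : ℕ} where

  IsCircuit : Matroid n → ESet n → Set
  IsCircuit M C = ¬ Indep M C × (∀ e → e ∈ₑ C → Indep M (C ∖ₑ e))

  Ends : Edge n → Fin n → Fin n → Set
  Ends ((a , b) , _) u v = (a ≡ u × b ≡ v) ⊎ (a ≡ v × b ≡ u)

  -- X is the edge set of a subgraph of K_n isomorphic to H_k = k disjoint copies of K_2
  -- (vertices of H_k: Fin k ⊎ Fin k; edges: {inj₁ i , inj₂ i}; φ an injective vertex map)
  IsHkSet : ℕ → ESet n → Set
  IsHkSet k X = Σ (Fin k ⊎ Fin k → Fin n) λ φ →
                  Injective _≡_ _≡_ φ ×
                  (∀ e → e ∈ₑ X ⇔ ∃ λ (i : Fin k) → Ends e (φ (inj₁ i)) (φ (inj₂ i)))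

  IsHkMatroid : ℕ → Matroid n → Set
  IsHkMatroid k M = ∀ X → IsHkSet k X → IsCircuit M X

  _⪯_ : Matroid n → Matroid n → Set
  M₁ ⪯ M₂ = ∀ X → Indep M₁ X → Indep M₂ X

  ⋃ₑ : List (ESet n) → ESet n
  ⋃ₑ = foldr _∪ₑ_ ∅ₑ

  ProperSeq : ℕ → List (ESet n) → Set
  ProperSeq k S = All (IsHkSet k) S ×
                  (∀ (i : Fin (length S)) → 1 ≤ toℕ i →
                     ¬ (lookup S i ⊆ₑ ⋃ₑ (take (toℕ i) S)))

  val : ESet n → List (ESet n) → ℕ
  val F S = card (F ∪ₑ ⋃ₑ S) ∸ length S

  IsValH : ℕ → ESet n → ℕ → Set
  IsValH k F v = (Σ (List (ESet n)) λ S → ProperSeq k S × val F S ≡ v) ×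
                 (∀ S → ProperSeq k S → v ≤ val F S)

  IsRank : Matroid n → ESet n → ℕ → Set
  IsRank M F r = (Σ (ESet n) λ Y → Y ⊆ₑ F × Indep M Y × card Y ≡ r) ×
                 (∀ Y → Y ⊆ₑ F → Indep M Y → card Y ≤ r)

{-# OPTIONS --safe #-}
module Submission where

-- U_{k-1} is an H_k-matroid because every copy of H_k has exactly k edges. Everything else rests
-- on a proper sequence X₁, …, X_m of copies of H_k that covers E(K_n) and in which each X_i (i ≥ 2)
-- has exactly one edge e_i outside X₁ ∪ … ∪ X_{i-1}. As X_i is a circuit inside that union plus e_i,
-- adding e_i does not raise the rank of the union in an H_k-matroid; so every H_k-matroid has rank
-- at most k - 1, i.e. lies below U_{k-1}, and val(F, (X_i)) = k - 1 for every F. Conversely every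
-- nonempty proper sequence has |⋃ X_i| ≥ m + k - 1, whence val_{H_k}(F) = min(|F|, k - 1).
-- The sequence starts from a fixed copy X₁. An edge meeting at most one edge of X₁ is covered by
-- swapping it for that edge. An edge uv with u on the edge uu′ and v on another edge of X₁ is then
-- covered by the copy made of uv, the already covered edge u′w for a vertex w outside X₁ (this is
-- where n ≥ 2k + 1 is used), and the edges of X₁ not meeting uv.

open import Defs
open import Data.Nat using (ℕ; zero; suc; _*_; _+_; _∸_; _≤_; _<_; z≤n; s≤s; _⊓_)
open import Data.Nat.Properties
open import Data.Nat.ListAction using (sum)
open import Data.Fin using (Fin; toℕ; fromℕ<; inject≤; join; splitAt) renaming (zero to fzero; suc to fsuc; _<_ to _<ᶠ_; _≟_ to _≟ᶠ_)
open import Data.Fin.Properties using (toℕ-injective; toℕ<n; toℕ-fromℕ<; toℕ-inject≤; inject≤-injective; splitAt-join) renaming (_<?_ to _<ᶠ?_)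
import Data.Fin.Properties as Finₚ
open import Data.List using (List; []; _∷_; _++_; map; concatMap; allFin; length; lookup; take; _∷ʳ_)
open import Data.List.Properties using (concatMap-cong; map-cong; map-tabulate; length-++; take-suc; take-all)
open import Data.List.Relation.Unary.All using ([]; _∷_)
open import Data.List.Relation.Unary.All.Properties using (++⁺)
open import Data.List.Membership.Propositional using (_∈_; lose)
open import Data.List.Relation.Unary.Any using (here; there; satisfied)
import Data.List.Relation.Unary.Any as Any
open import Data.Bool using (Bool; true; false; if_then_else_; _∨_; _∧_)
open import Data.Bool.Properties using (∨-zeroʳ; ∨-identityʳ; ∨-assoc; ∧-zeroʳ; ¬-not; not-¬) renaming (_≟_ to _≟ᵇ_)
open import Data.Product using (Σ; _×_; _,_; proj₁; proj₂; ∃)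
open import Data.Sum using (_⊎_; inj₁; inj₂; [_,_]′; reduce; swap)
open import Data.Sum.Properties using (inj₁-injective)
open import Data.Empty using (⊥-elim)
open import Relation.Nullary using (¬_; Dec; yes; no; does; contradiction)
open import Relation.Unary using (Decidable)
open import Relation.Nullary.Decidable using (_×-dec_)
open import Relation.Binary.PropositionalEquality
open import Function.Base using (_∘_; id; case_of_)
import Function.Properties.Equivalence as ⇔
open import Function.Bundles using (_⇔_; mk⇔; Equivalence)
open import Function.Definitions using (Injective)

∨-true⁻ : ∀ {a b : Bool} → a ∨ b ≡ true → a ≡ true ⊎ b ≡ true
∨-true⁻ {true}  _ = inj₁ refl
∨-true⁻ {false} h = inj₂ h

∨-trueˡ : ∀ {a : Bool} b → a ≡ true → a ∨ b ≡ true
∨-trueˡ b refl = refl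

∨-trueʳ : ∀ a {b : Bool} → b ≡ true → a ∨ b ≡ true
∨-trueʳ a refl = ∨-zeroʳ a

bool-ext : ∀ {a b : Bool} → (a ≡ true ⇔ b ≡ true) → a ≡ b
bool-ext {true}  a⇔b = sym (Equivalence.to a⇔b refl)
bool-ext {false} {false} a⇔b = refl
bool-ext {false} {true}  a⇔b = Equivalence.from a⇔b refl

ind : Bool → ℕ
ind b = if b then 1 else 0

sum-map-0 : ∀ {A : Set} (xs : List A) → sum (map (λ _ → 0) xs) ≡ 0
sum-map-0 []       = refl
sum-map-0 (_ ∷ xs) = sum-map-0 xs

sum-allFin-suc : ∀ {m} (f : Fin (suc m) → ℕ) →
                 sum (map f (allFin (suc m))) ≡ f fzero + sum (map (f ∘ fsuc) (allFin m))
sum-allFin-suc {m} f = cong (λ xs → f fzero + sum xs)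
  (trans (map-tabulate fsuc f) (sym (map-tabulate id (f ∘ fsuc))))

sum-ind-≟ : ∀ {m} (a : Fin m) → sum (map (λ i → ind (does (i ≟ᶠ a))) (allFin m)) ≡ 1
sum-ind-≟ {suc m} fzero    = trans (sum-allFin-suc {m} (λ i → ind (does (i ≟ᶠ fzero)))) (cong suc (sum-map-0 (allFin m)))
sum-ind-≟ {suc m} (fsuc a) = trans (sum-allFin-suc {m} (λ i → ind (does (i ≟ᶠ fsuc a)))) (sum-ind-≟ a)

-- Cardinality of edge sets

listEdge : ∀ {n} (i j : Fin n) → List (Edge n)
listEdge i j with i <ᶠ? j
... | yes i<j = ((i , j) , i<j) ∷ []
... | no  _   = []

mutual
  allEdges≡ : ∀ n → allEdges n ≡ concatMap (λ i → concatMap (listEdge i) (allFin n)) (allFin n)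
  allEdges≡ n = concatMap-cong (λ i → concatMap-cong (pick≡listEdge i) (allFin n)) (allFin n)

  -- The left-hand side is the function `pick` local to `allEdges`, which cannot be named here.
  pick≡listEdge : ∀ {n} (i j : Fin n) → _ ≡ listEdge i j
  pick≡listEdge i j with i <ᶠ? j
  ... | yes _ = refl
  ... | no  _ = refl

module _ {A : Set} where

  lookup-∷ʳ-< : ∀ (xs : List A) x (i : Fin (length (xs ∷ʳ x))) (i< : toℕ i < length xs) →
                lookup (xs ∷ʳ x) i ≡ lookup xs (fromℕ< i<)
  lookup-∷ʳ-< (y ∷ xs) x fzero    i< = refl
  lookup-∷ʳ-< (y ∷ xs) x (fsuc i) i< = lookup-∷ʳ-< xs x i (≤-pred i<)

  lookup-∷ʳ-last : ∀ (xs : List A) x (i : Fin (length (xs ∷ʳ x))) → toℕ i ≡ length xs → lookup (xs ∷ʳ x) i ≡ x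
  lookup-∷ʳ-last []       x fzero    _  = refl
  lookup-∷ʳ-last (y ∷ xs) x (fsuc i) eq = lookup-∷ʳ-last xs x i (suc-injective eq)

  take-∷ʳ : ∀ (xs : List A) x m → m ≤ length xs → take m (xs ∷ʳ x) ≡ take m xs
  take-∷ʳ xs       x zero    _   = refl
  take-∷ʳ (y ∷ xs) x (suc m) m≤ = cong (y ∷_) (take-∷ʳ xs x m (≤-pred m≤))

HkVertex : ℕ → Set
HkVertex k = Fin k ⊎ Fin k

pairOf : ∀ {k} → HkVertex k → Fin k
pairOf = reduce

module _ {n : ℕ} where

  eqE-refl : (e : Edge n) → eqE e e ≡ true
  eqE-refl ((a , b) , _) with a ≟ᶠ a | b ≟ᶠ b
  ... | yes _ | yes _ = refl
  ... | yes _ | no b≢b = contradiction refl b≢b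
  ... | no a≢a | _ = contradiction refl a≢a

  eqE⇒≡ : ∀ (f e : Edge n) → eqE f e ≡ true → f ≡ e
  eqE⇒≡ ((a , b) , p) ((c , d) , q) h with a ≟ᶠ c | b ≟ᶠ d
  eqE⇒≡ ((a , b) , p) ((a , b) , q) h | yes refl | yes refl = cong ((a , b) ,_) (<-irrelevant p q)
  eqE⇒≡ ((a , b) , p) ((c , d) , q) () | yes _ | no _
  eqE⇒≡ ((a , b) , p) ((c , d) , q) () | no _ | _

  ∈⁅⁆ : (e : Edge n) → e ∈ₑ ⁅ e ⁆ₑ
  ∈⁅⁆ = eqE-refl

  ≡⇒∈⁅⁆ : ∀ {f e : Edge n} → f ≡ e → f ∈ₑ ⁅ e ⁆ₑ
  ≡⇒∈⁅⁆ {f} refl = ∈⁅⁆ f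

  _≟ₑ_ : (f e : Edge n) → Dec (f ≡ e)
  f ≟ₑ e with eqE f e in eq
  ... | true  = yes (eqE⇒≡ f e eq)
  ... | false = no λ { refl → contradiction (trans (sym (eqE-refl f)) eq) λ () }

  count : List (Edge n) → ESet n → ℕ
  count L X = sum (map (ind ∘ X) L)

  count-cong : ∀ L {X Y : ESet n} → (∀ e → X e ≡ Y e) → count L X ≡ count L Y
  count-cong L X≐Y = cong sum (map-cong (λ e → cong ind (X≐Y e)) L)

  count-∅ : ∀ L → count L ∅ₑ ≡ 0
  count-∅ []      = refl
  count-∅ (_ ∷ L) = count-∅ L

  count-mono : ∀ L {X Y : ESet n} → X ⊆ₑ Y → count L X ≤ count L Y
  count-mono []      X⊆Y = z≤n
  count-mono (x ∷ L) {X} {Y} X⊆Y with X x in xx | Y x in yx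
  ... | true  | true  = s≤s (count-mono L X⊆Y)
  ... | true  | false = contradiction (trans (sym (X⊆Y x xx)) yx) λ ()
  ... | false | true  = m≤n⇒m≤1+n (count-mono L X⊆Y)
  ... | false | false = count-mono L X⊆Y

  count-< : ∀ L {X Y : ESet n} {e} → X ⊆ₑ Y → e ∈ L → X e ≡ false → Y e ≡ true → count L X < count L Y
  count-< (x ∷ L) X⊆Y (here refl) xe ye rewrite xe | ye = s≤s (count-mono L X⊆Y)
  count-< (x ∷ L) {X} {Y} X⊆Y (there e∈L) xe ye with X x in xx | Y x in yx
  ... | true  | true  = s≤s (count-< L X⊆Y e∈L xe ye)
  ... | true  | false = contradiction (trans (sym (X⊆Y x xx)) yx) λ ()
  ... | false | true  = m<n⇒m<1+n (count-< L X⊆Y e∈L xe ye)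
  ... | false | false = count-< L X⊆Y e∈L xe ye

  count-<⇒∃ : ∀ L {X Y : ESet n} → count L X < count L Y → ∃ λ e → Y e ≡ true × X e ≡ false
  count-<⇒∃ (x ∷ L) {X} {Y} lt with X x in xx | Y x in yx
  ... | false | true  = x , yx , xx
  ... | true  | true  = count-<⇒∃ L (≤-pred lt)
  ... | true  | false = count-<⇒∃ L (<-trans (n<1+n _) lt)
  ... | false | false = count-<⇒∃ L lt

  count-pos⇒∈ : ∀ L {X : ESet n} → 0 < count L X → ∃ λ e → e ∈ L × X e ≡ true
  count-pos⇒∈ (x ∷ L) {X} pos with X x in xx
  ... | true  = x , here refl , xx
  ... | false with count-pos⇒∈ L pos
  ...   | e , e∈L , xe = e , there e∈L , xe

  count-∪ : ∀ L {X Y : ESet n} → (∀ e → X e ≡ true → Y e ≡ false) →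
            count L (X ∪ₑ Y) ≡ count L X + count L Y
  count-∪ []      disj = refl
  count-∪ (x ∷ L) {X} {Y} disj with X x in xx | Y x in yx
  ... | true  | true  = contradiction (trans (sym (disj x xx)) yx) λ ()
  ... | true  | false = cong suc (count-∪ L disj)
  ... | false | true  = trans (cong suc (count-∪ L disj)) (sym (+-suc _ _))
  ... | false | false = count-∪ L disj

  count-++ : ∀ L M X → count (L ++ M) X ≡ count L X + count M X
  count-++ []      M X = refl
  count-++ (x ∷ L) M X = trans (cong (_ +_) (count-++ L M X)) (sym (+-assoc (ind (X x)) _ _))

  count-concatMap : ∀ {A : Set} (F : A → List (Edge n)) xs X →
                    count (concatMap F xs) X ≡ sum (map (λ a → count (F a) X) xs)
  count-concatMap F []       X = refl
  count-concatMap F (a ∷ xs) X = trans (count-++ (F a) _ X) (cong (_ +_) (count-concatMap F xs X))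

  count-listEdge : ∀ (i j a b : Fin n) (a<b : a <ᶠ b) →
                   count (listEdge i j) ⁅ (a , b) , a<b ⁆ₑ ≡ ind (does (i ≟ᶠ a) ∧ does (j ≟ᶠ b))
  count-listEdge i j a b a<b with i <ᶠ? j
  ... | yes _ = +-identityʳ _
  ... | no i≮j with i ≟ᶠ a | j ≟ᶠ b
  ...   | yes refl | yes refl = contradiction a<b i≮j
  ...   | yes _    | no  _    = refl
  ...   | no  _    | _        = refl

  card-⁅⁆ : (e : Edge n) → card ⁅ e ⁆ₑ ≡ 1
  card-⁅⁆ e@((a , b) , a<b) = begin
    count (allEdges n) ⁅ e ⁆ₑ
      ≡⟨ cong (λ L → count L ⁅ e ⁆ₑ) (allEdges≡ n) ⟩
    count (concatMap (λ i → concatMap (listEdge i) (allFin n)) (allFin n)) ⁅ e ⁆ₑ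
      ≡⟨ count-concatMap _ (allFin n) _ ⟩
    sum (map (λ i → count (concatMap (listEdge i) (allFin n)) ⁅ e ⁆ₑ) (allFin n))
      ≡⟨ cong sum (map-cong row (allFin n)) ⟩
    sum (map (λ i → ind (does (i ≟ᶠ a))) (allFin n))
      ≡⟨ sum-ind-≟ a ⟩
    1 ∎
    where
    open ≡-Reasoning
    row-sum : ∀ i → sum (map (λ j → ind (does (i ≟ᶠ a) ∧ does (j ≟ᶠ b))) (allFin n)) ≡ ind (does (i ≟ᶠ a))
    row-sum i with i ≟ᶠ a
    ... | yes _ = sum-ind-≟ b
    ... | no  _ = sum-map-0 (allFin n)
    row : ∀ i → count (concatMap (listEdge i) (allFin n)) ⁅ e ⁆ₑ ≡ ind (does (i ≟ᶠ a))
    row i = trans (count-concatMap (listEdge i) (allFin n) _)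
                  (trans (cong sum (map-cong (λ j → count-listEdge i j a b a<b) (allFin n))) (row-sum i))

  ∈-allEdges : (e : Edge n) → e ∈ allEdges n
  ∈-allEdges e with count-pos⇒∈ (allEdges n) {⁅ e ⁆ₑ} (subst (0 <_) (sym (card-⁅⁆ e)) (s≤s z≤n))
  ... | f , f∈ , f∈⁅e⁆ = subst (_∈ allEdges n) (eqE⇒≡ f e f∈⁅e⁆) f∈

  card-cong : ∀ {X Y : ESet n} → (∀ e → X e ≡ Y e) → card X ≡ card Y
  card-cong = count-cong (allEdges n)

  card-∅ : card (∅ₑ {n}) ≡ 0
  card-∅ = count-∅ (allEdges n)

  card-mono : ∀ {X Y : ESet n} → X ⊆ₑ Y → card X ≤ card Y
  card-mono = count-mono (allEdges n)

  card-< : ∀ {X Y : ESet n} {e} → X ⊆ₑ Y → X e ≡ false → Y e ≡ true → card X < card Y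
  card-< {e = e} X⊆Y = count-< (allEdges n) X⊆Y (∈-allEdges e)

  card-<⇒∃ : ∀ {X Y : ESet n} → card X < card Y → ∃ λ e → Y e ≡ true × X e ≡ false
  card-<⇒∃ = count-<⇒∃ (allEdges n)

  disjoint-⁅⁆ : ∀ {X : ESet n} {e} → X e ≡ false → ∀ f → f ∈ₑ X → ⁅ e ⁆ₑ f ≡ false
  disjoint-⁅⁆ {X} {e} Xe f Xf with eqE f e in eq
  ... | false = refl
  ... | true  = contradiction (trans (sym Xf) (subst (λ g → X g ≡ false) (sym (eqE⇒≡ f e eq)) Xe)) λ ()

  card-∪⁅⁆ : ∀ {X : ESet n} {e} → X e ≡ false → card (X ∪ₑ ⁅ e ⁆ₑ) ≡ suc (card X)
  card-∪⁅⁆ {X} {e} Xe = begin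
    card (X ∪ₑ ⁅ e ⁆ₑ)   ≡⟨ count-∪ (allEdges n) (disjoint-⁅⁆ {X} {e} Xe) ⟩
    card X + card ⁅ e ⁆ₑ ≡⟨ cong (card X +_) (card-⁅⁆ e) ⟩
    card X + 1           ≡⟨ +-comm (card X) 1 ⟩
    suc (card X)         ∎
    where open ≡-Reasoning

  ∖⊆ : ∀ {X : ESet n} {e} → (X ∖ₑ e) ⊆ₑ X
  ∖⊆ {X} f h with X f
  ... | true = refl

  ∈-∪⁅⁆⁻ : ∀ {E : ESet n} {e f} → f ∈ₑ (E ∪ₑ ⁅ e ⁆ₑ) → f ∈ₑ E ⊎ f ≡ e
  ∈-∪⁅⁆⁻ {E} {e} {f} h with ∨-true⁻ {E f} h
  ... | inj₁ Ef  = inj₁ Ef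
  ... | inj₂ f≡e = inj₂ (eqE⇒≡ f e f≡e)

  ∈-∪⁅⁆-≢ : ∀ {E : ESet n} {e f} → f ∈ₑ (E ∪ₑ ⁅ e ⁆ₑ) → f ≢ e → f ∈ₑ E
  ∈-∪⁅⁆-≢ {E} {e} {f} h f≢e with ∈-∪⁅⁆⁻ {E} {e} {f} h
  ... | inj₁ Ef  = Ef
  ... | inj₂ f≡e = contradiction f≡e f≢e

  ∈-∖⇒≢ : ∀ {X : ESet n} {e f} → f ∈ₑ (X ∖ₑ e) → f ≢ e
  ∈-∖⇒≢ {X} {e} {f} h refl rewrite eqE-refl f = contradiction (trans (sym h) (∧-zeroʳ (X f))) λ ()

  ∖-∪⁅⁆ : ∀ {X : ESet n} {e} → e ∈ₑ X → ∀ f → X f ≡ ((X ∖ₑ e) ∪ₑ ⁅ e ⁆ₑ) f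
  ∖-∪⁅⁆ {X} {e} Xe f with eqE f e in eq
  ... | true  = trans (subst (λ g → X g ≡ true) (sym (eqE⇒≡ f e eq)) Xe) (sym (∨-zeroʳ _))
  ... | false with X f
  ...   | true  = refl
  ...   | false = refl

  card-∖ : ∀ {X : ESet n} {e} → e ∈ₑ X → card X ≡ suc (card (X ∖ₑ e))
  card-∖ {X} {e} Xe = trans (card-cong (∖-∪⁅⁆ Xe)) (card-∪⁅⁆ e∉X∖e)
    where
    e∉X∖e : (X ∖ₑ e) e ≡ false
    e∉X∖e rewrite eqE-refl e = ∧-zeroʳ (X e)

  ⊆-card-≥⇒⊇ : ∀ {X Y : ESet n} → X ⊆ₑ Y → card Y ≤ card X → Y ⊆ₑ X
  ⊆-card-≥⇒⊇ {X} X⊆Y Y≤X e Ye with X e in Xe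
  ... | true  = refl
  ... | false = contradiction (card-< X⊆Y Xe Ye) (≤⇒≯ Y≤X)

  ⊈⇒∃ : ∀ {X Y : ESet n} → ¬ (X ⊆ₑ Y) → ∃ λ e → X e ≡ true × Y e ≡ false
  ⊈⇒∃ {X} {Y} X⊈Y with Any.any? (λ e → (X e ≟ᵇ true) ×-dec (Y e ≟ᵇ false)) (allEdges n)
  ... | yes found = satisfied found
  ... | no  none  = contradiction X⊆Y X⊈Y
    where
    X⊆Y : X ⊆ₑ Y
    X⊆Y e Xe with Y e in Ye
    ... | true  = refl
    ... | false = contradiction (lose (∈-allEdges e) (Xe , Ye)) none

  subset-of-card : ∀ d m (X : ESet n) → card X ≡ m + d → ∃ λ Y → Y ⊆ₑ X × card Y ≡ m
  subset-of-card zero    m X eq = X , (λ _ h → h) , trans eq (+-identityʳ m)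
  subset-of-card (suc d) m X eq with card-<⇒∃ {∅ₑ} {X} (subst₂ _<_ (sym card-∅) (sym (trans eq (+-suc m d))) (s≤s z≤n))
  ... | e , Xe , _ with subset-of-card d m (X ∖ₑ e) (suc-injective (trans (sym (card-∖ Xe)) (trans eq (+-suc m d))))
  ...   | Y , Y⊆ , cardY = Y , (λ f h → ∖⊆ {X} {e} f (Y⊆ f h)) , cardY

  -- Copies of H_k and the uniform matroid

  Ends-unique : ∀ {f g : Edge n} {a b} → Ends f a b → Ends g a b → f ≡ g
  Ends-unique {(_ , p)} {(_ , q)} (inj₁ (refl , refl)) (inj₁ (refl , refl)) = cong (_ ,_) (<-irrelevant p q)
  Ends-unique {(_ , p)} {(_ , q)} (inj₂ (refl , refl)) (inj₂ (refl , refl)) = cong (_ ,_) (<-irrelevant p q)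
  Ends-unique {(_ , p)} {(_ , q)} (inj₁ (refl , refl)) (inj₂ (refl , refl)) = contradiction q (<-asym p)
  Ends-unique {(_ , p)} {(_ , q)} (inj₂ (refl , refl)) (inj₁ (refl , refl)) = contradiction q (<-asym p)

  Ends-match : ∀ {f : Edge n} {a b c d} → Ends f a b → Ends f c d → (a ≡ c × b ≡ d) ⊎ (a ≡ d × b ≡ c)
  Ends-match (inj₁ (refl , refl)) (inj₁ (refl , refl)) = inj₁ (refl , refl)
  Ends-match (inj₁ (refl , refl)) (inj₂ (refl , refl)) = inj₂ (refl , refl)
  Ends-match (inj₂ (refl , refl)) (inj₁ (refl , refl)) = inj₂ (refl , refl)
  Ends-match (inj₂ (refl , refl)) (inj₂ (refl , refl)) = inj₁ (refl , refl)

  mkEdge : (a b : Fin n) → a ≢ b → Edge n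
  mkEdge a b a≢b with a <ᶠ? b
  ... | yes a<b = (a , b) , a<b
  ... | no  a≮b = (b , a) , ≤∧≢⇒< (≮⇒≥ a≮b) (λ eq → a≢b (toℕ-injective (sym eq)))

  Ends-mkEdge : ∀ a b (a≢b : a ≢ b) → Ends (mkEdge a b a≢b) a b
  Ends-mkEdge a b a≢b with a <ᶠ? b
  ... | yes _ = inj₁ (refl , refl)
  ... | no  _ = inj₂ (refl , refl)

  image : ∀ {m} → (Fin m → Edge n) → ESet n
  image {zero}  g = ∅ₑ
  image {suc m} g = image (g ∘ fsuc) ∪ₑ ⁅ g fzero ⁆ₑ

  image-∈⁻ : ∀ {m} (g : Fin m → Edge n) f → f ∈ₑ image g → ∃ λ i → f ≡ g i
  image-∈⁻ {suc m} g f f∈ with ∨-true⁻ {image (g ∘ fsuc) f} f∈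
  ... | inj₁ f∈′ = let i , f≡ = image-∈⁻ (g ∘ fsuc) f f∈′ in fsuc i , f≡
  ... | inj₂ f≡g0 = fzero , eqE⇒≡ f (g fzero) f≡g0

  image-∈ : ∀ {m} (g : Fin m → Edge n) i → g i ∈ₑ image g
  image-∈ {suc m} g fzero    = ∨-trueʳ _ (∈⁅⁆ (g fzero))
  image-∈ {suc m} g (fsuc i) = ∨-trueˡ _ (image-∈ (g ∘ fsuc) i)

  card-image : ∀ {m} (g : Fin m → Edge n) → Injective _≡_ _≡_ g → card (image g) ≡ m
  card-image {zero}  g g-inj = card-∅
  card-image {suc m} g g-inj =
    trans (card-∪⁅⁆ {image (g ∘ fsuc)} {g fzero} (¬-not g0∉))
          (cong suc (card-image (g ∘ fsuc) (λ eq → Finₚ.suc-injective (g-inj eq))))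
    where
    g0∉ : ¬ (g fzero ∈ₑ image (g ∘ fsuc))
    g0∉ g0∈ with image-∈⁻ (g ∘ fsuc) (g fzero) g0∈
    ... | i , eq with g-inj eq
    ... | ()

  module _ {k : ℕ} (φ : HkVertex k → Fin n) where

    PairEdge : Fin k → Edge n → Set
    PairEdge l e = Ends e (φ (inj₁ l)) (φ (inj₂ l))

  module _ {k : ℕ} (φ : HkVertex k → Fin n) (φ-inj : Injective _≡_ _≡_ φ) where

    pairEdge : Fin k → Edge n
    pairEdge l = mkEdge (φ (inj₁ l)) (φ (inj₂ l)) (λ eq → case φ-inj eq of λ ())

    matching : ESet n
    matching = image pairEdge

    matching-∈ : ∀ e → e ∈ₑ matching ⇔ ∃ λ l → PairEdge φ l e
    matching-∈ e = mk⇔ to from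
      where
      to : e ∈ₑ matching → ∃ λ l → PairEdge φ l e
      to e∈ with image-∈⁻ pairEdge e e∈
      ... | l , refl = l , Ends-mkEdge _ _ _
      from : (∃ λ l → PairEdge φ l e) → e ∈ₑ matching
      from (l , ends) = subst (_∈ₑ matching) (Ends-unique (Ends-mkEdge _ _ _) ends) (image-∈ pairEdge l)

    matching-isHk : IsHkSet k matching
    matching-isHk = φ , φ-inj , matching-∈

    pairEdge-injective : Injective _≡_ _≡_ pairEdge
    pairEdge-injective {i} {j} eq
      with Ends-match {pairEdge j} (subst (PairEdge φ i) eq (Ends-mkEdge _ _ _)) (Ends-mkEdge _ _ _)
    ... | inj₁ (φi≡φj , _) = inj₁-injective (φ-inj φi≡φj)
    ... | inj₂ (φi≡φj , _) = case φ-inj φi≡φj of λ ()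

  card-Hk : ∀ {k} {X : ESet n} → IsHkSet k X → card X ≡ k
  card-Hk {X = X} (φ , φ-inj , X-∈) =
    trans (card-cong (λ e → bool-ext (⇔.trans (X-∈ e) (⇔.sym (matching-∈ φ φ-inj e)))))
          (card-image (pairEdge φ φ-inj) (pairEdge-injective φ φ-inj))

  uniform : ℕ → Matroid n
  uniform r = record
    { Indep     = λ X → card X ≤ r
    ; indep-∅   = subst (_≤ r) (sym (card-∅)) z≤n
    ; indep-⊆   = λ Y⊆X X≤r → ≤-trans (card-mono Y⊆X) X≤r
    ; indep-aug = augment
    }
    where
    augment : ∀ {X Y : ESet n} → card X ≤ r → card Y ≤ r → card X < card Y →
              Σ (Edge n) λ e → e ∈ₑ Y × ¬ (e ∈ₑ X) × card (X ∪ₑ ⁅ e ⁆ₑ) ≤ r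
    augment {X} _ Y≤r X<Y with card-<⇒∃ X<Y
    ... | e , Ye , Xe = e , Ye , not-¬ Xe , subst (_≤ r) (sym (card-∪⁅⁆ {X} Xe)) (≤-trans X<Y Y≤r)

  module _ {r : ℕ} where

    uniform-circuit : ∀ {C : ESet n} → card C ≡ suc r → IsCircuit (uniform r) C
    uniform-circuit {C} cardC =
      (λ C≤r → 1+n≰n (subst (_≤ r) cardC C≤r)) ,
      (λ e Ce → ≤-reflexive (suc-injective (trans (sym (card-∖ {C} Ce)) cardC)))

    uniform-isHk : IsHkMatroid (suc r) (uniform r)
    uniform-isHk X X-Hk = uniform-circuit (card-Hk X-Hk)

    uniform-rank : ∀ F → IsRank (uniform r) F (card F ⊓ r)
    uniform-rank F with subset-of-card (card F ∸ card F ⊓ r) (card F ⊓ r) F (sym (m+[n∸m]≡n (m⊓n≤m (card F) r)))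
    ... | Y , Y⊆F , cardY =
      (Y , Y⊆F , subst (_≤ r) (sym cardY) (m⊓n≤n (card F) r) , cardY) ,
      (λ Z Z⊆F Z≤r → ⊓-glb (card-mono Z⊆F) Z≤r)

  -- Proper sequences and rank bounds

  ⋃-∷ʳ : ∀ (S : List (ESet n)) X f → ⋃ₑ (S ∷ʳ X) f ≡ (⋃ₑ S f ∨ X f)
  ⋃-∷ʳ []      X f = ∨-identityʳ (X f)
  ⋃-∷ʳ (Y ∷ S) X f rewrite ⋃-∷ʳ S X f = sym (∨-assoc (Y f) _ _)

  ⋃-⊆-∷ʳ : ∀ (S : List (ESet n)) X → ⋃ₑ S ⊆ₑ ⋃ₑ (S ∷ʳ X)
  ⋃-⊆-∷ʳ S X f h rewrite ⋃-∷ʳ S X f = ∨-trueˡ (X f) h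

  card-⋃-∷ʳ : ∀ (S : List (ESet n)) {X} → ¬ (X ⊆ₑ ⋃ₑ S) → suc (card (⋃ₑ S)) ≤ card (⋃ₑ (S ∷ʳ X))
  card-⋃-∷ʳ S {X} X⊈ with ⊈⇒∃ X⊈
  ... | e , Xe , ⋃e = card-< (⋃-⊆-∷ʳ S X) ⋃e (trans (⋃-∷ʳ S X e) (∨-trueʳ _ Xe))

  proper-∷ʳ : ∀ {k} {S : List (ESet n)} {X} → ProperSeq k S → IsHkSet k X → ¬ (X ⊆ₑ ⋃ₑ S) → ProperSeq k (S ∷ʳ X)
  proper-∷ʳ {k} {S} {X} (S-Hk , S-new) X-Hk X-new = ++⁺ S-Hk (X-Hk ∷ []) , new
    where
    new : ∀ i → 1 ≤ toℕ i → ¬ (lookup (S ∷ʳ X) i ⊆ₑ ⋃ₑ (take (toℕ i) (S ∷ʳ X)))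
    new i 1≤i with m≤n⇒m<n∨m≡n (≤-pred (subst (toℕ i <_) (trans (length-++ S) (+-comm (length S) 1)) (toℕ<n i)))
    ... | inj₁ i< rewrite lookup-∷ʳ-< S X i i< | take-∷ʳ S X (toℕ i) (<⇒≤ i<) =
      subst (λ m → ¬ (lookup S (fromℕ< i<) ⊆ₑ ⋃ₑ (take m S))) (toℕ-fromℕ< i<)
            (S-new (fromℕ< i<) (subst (1 ≤_) (sym (toℕ-fromℕ< i<)) 1≤i))
    ... | inj₂ i≡
      rewrite lookup-∷ʳ-last S X i i≡ | i≡ | take-∷ʳ S X (length S) ≤-refl | take-all (length S) S ≤-refl = X-new

  card-⋃-take : ∀ {r} {S : List (ESet n)} → ProperSeq (suc r) S →
                ∀ m → m < length S → suc m + r ≤ card (⋃ₑ (take (suc m) S))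
  card-⋃-take {S = X ∷ S} (X-Hk ∷ _ , _) zero _ =
    ≤-reflexive (sym (trans (card-cong (λ f → ∨-identityʳ (X f))) (card-Hk X-Hk)))
  card-⋃-take {S = S} pS (suc m) m< =
    ≤-trans (s≤s (card-⋃-take pS m (<-trans (n<1+n m) m<))) (grows (fromℕ< m<) (toℕ-fromℕ< m<))
    where
    grows : ∀ i → toℕ i ≡ suc m → suc (card (⋃ₑ (take (suc m) S))) ≤ card (⋃ₑ (take (suc (suc m)) S))
    grows i eq rewrite sym eq | take-suc S i =
      card-⋃-∷ʳ (take (toℕ i) S) (proj₂ pS i (subst (1 ≤_) (sym eq) (s≤s z≤n)))

  card-⋃-proper : ∀ {r} {X} {S : List (ESet n)} → ProperSeq (suc r) (X ∷ S) →
                  length (X ∷ S) + r ≤ card (⋃ₑ (X ∷ S))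
  card-⋃-proper {r} {X} {S} pS = subst (λ T → length (X ∷ S) + r ≤ card (⋃ₑ T))
                                       (take-all (length (X ∷ S)) (X ∷ S) ≤-refl) (card-⋃-take pS (length S) ≤-refl)

  RankAtMost : Matroid n → ESet n → ℕ → Set
  RankAtMost M E r = ∀ I → I ⊆ₑ E → Indep M I → card I ≤ r

  rankAtMost-⊆ : ∀ {M : Matroid n} {E E′ r} → E′ ⊆ₑ E → RankAtMost M E r → RankAtMost M E′ r
  rankAtMost-⊆ E′⊆E E≤r I I⊆E′ = E≤r I (λ f h → E′⊆E f (I⊆E′ f h))

  module _ {M : Matroid n} {C : ESet n} {r : ℕ} (C-circuit : IsCircuit M C) (cardC : card C ≡ suc r) where

    card-circuit-∖ : ∀ {e} → e ∈ₑ C → card (C ∖ₑ e) ≡ r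
    card-circuit-∖ Ce = suc-injective (trans (sym (card-∖ Ce)) cardC)

    rankAtMost-circuit : RankAtMost M C r
    rankAtMost-circuit I I⊆C indI with card I ≤? r
    ... | yes I≤r = I≤r
    ... | no  I≰r = ⊥-elim (proj₁ C-circuit (indep-⊆ M C⊆I indI))
      where
      C⊆I : C ⊆ₑ I
      C⊆I = ⊆-card-≥⇒⊇ I⊆C (subst (_≤ card I) (sym cardC) (≰⇒> I≰r))

    -- Augment C ∖ e, independent of size r, from I: the new edge is either e, recreating C,
    -- or an edge of E, giving r + 1 independent edges inside E.
    rankAtMost-∪⁅⁆ : ∀ {E e} → e ∈ₑ C → C ⊆ₑ (E ∪ₑ ⁅ e ⁆ₑ) → RankAtMost M E r → RankAtMost M (E ∪ₑ ⁅ e ⁆ₑ) r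
    rankAtMost-∪⁅⁆ {E} {e} Ce C⊆ E≤r I I⊆ indI with I e in Ie | card I ≤? r
    ... | false | _       =
      E≤r I (λ f If → ∈-∪⁅⁆-≢ {E} {e} {f} (I⊆ f If) (λ { refl → contradiction (trans (sym If) Ie) λ () })) indI
    ... | true  | yes I≤r = I≤r
    ... | true  | no  I≰r
      with indep-aug M (proj₂ C-circuit e Ce) indI (subst (_< card I) (sym (card-circuit-∖ {e} Ce)) (≰⇒> I≰r))
    ...   | f , If , f∉K , indK+f with f ≟ₑ e
    ...     | yes refl = contradiction (indep-⊆ M C⊆K+e indK+f) (proj₁ C-circuit)
      where
      C⊆K+e : C ⊆ₑ ((C ∖ₑ e) ∪ₑ ⁅ e ⁆ₑ)
      C⊆K+e g Cg = trans (sym (∖-∪⁅⁆ {C} {e} Ce g)) Cg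
    ...     | no  f≢e = ⊥-elim (1+n≰n (subst (_≤ r) card-K+f (E≤r _ K+f⊆E indK+f)))
      where
      card-K+f : card ((C ∖ₑ e) ∪ₑ ⁅ f ⁆ₑ) ≡ suc r
      card-K+f = trans (card-∪⁅⁆ {C ∖ₑ e} {f} (¬-not f∉K)) (cong suc (card-circuit-∖ {e} Ce))
      K+f⊆E : ((C ∖ₑ e) ∪ₑ ⁅ f ⁆ₑ) ⊆ₑ E
      K+f⊆E g g∈ with ∈-∪⁅⁆⁻ {C ∖ₑ e} {f} {g} g∈
      ... | inj₁ Kg  = ∈-∪⁅⁆-≢ {E} {e} {g} (C⊆ g (∖⊆ {C} {e} g Kg)) (∈-∖⇒≢ {C} {e} {g} Kg)
      ... | inj₂ g≡f = subst (_∈ₑ E) (sym g≡f) (∈-∪⁅⁆-≢ {E} {e} {f} (I⊆ f If) f≢e)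

  val-proper : ∀ {r F X} {S : List (ESet n)} → ProperSeq (suc r) (X ∷ S) → r ≤ val F (X ∷ S)
  val-proper {r} {F} {X} {S} pS = begin
    r                                        ≡⟨ m+n∸m≡n (length (X ∷ S)) r ⟨
    (length (X ∷ S) + r) ∸ length (X ∷ S)    ≤⟨ ∸-monoˡ-≤ (length (X ∷ S)) (card-⋃-proper pS) ⟩
    card (⋃ₑ (X ∷ S)) ∸ length (X ∷ S)       ≤⟨ ∸-monoˡ-≤ (length (X ∷ S)) (card-mono (λ f → ∨-trueʳ (F f))) ⟩
    card (F ∪ₑ ⋃ₑ (X ∷ S)) ∸ length (X ∷ S)  ∎
    where open ≤-Reasoning

  -- Chains of circuits

  Covers : ℕ → ESet n → Edge n → Set
  Covers k E e = Σ (ESet n) λ C → IsHkSet k C × e ∈ₑ C × C ⊆ₑ (E ∪ₑ ⁅ e ⁆ₑ)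

  covers-mono : ∀ {k E E′ e} → E ⊆ₑ E′ → Covers k E e → Covers k E′ e
  covers-mono {E = E} {e = e} E⊆E′ (C , C-Hk , Ce , C⊆) =
    C , C-Hk , Ce , λ f Cf → case ∈-∪⁅⁆⁻ {E} {e} {f} (C⊆ f Cf) of λ
    { (inj₁ Ef)  → ∨-trueˡ _ (E⊆E′ f Ef)
    ; (inj₂ f≡e) → ∨-trueʳ _ (≡⇒∈⁅⁆ f≡e) }

  ∪-covering : ∀ {E C : ESet n} {e} → e ∈ₑ C → C ⊆ₑ (E ∪ₑ ⁅ e ⁆ₑ) → ∀ f → (E ∪ₑ C) f ≡ (E ∪ₑ ⁅ e ⁆ₑ) f
  ∪-covering {E} {C} {e} Ce C⊆ f = bool-ext (mk⇔ to from)
    where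
    to : (E ∪ₑ C) f ≡ true → (E ∪ₑ ⁅ e ⁆ₑ) f ≡ true
    to h with ∨-true⁻ {E f} h
    ... | inj₁ Ef = ∨-trueˡ _ Ef
    ... | inj₂ Cf = C⊆ f Cf
    from : (E ∪ₑ ⁅ e ⁆ₑ) f ≡ true → (E ∪ₑ C) f ≡ true
    from h with ∈-∪⁅⁆⁻ {E} {e} {f} h
    ... | inj₁ Ef   = ∨-trueˡ _ Ef
    ... | inj₂ refl = ∨-trueʳ _ Ce

  record Chain (r : ℕ) : Set₁ where
    field
      seq    : List (ESet n)
      proper : ProperSeq (suc r) seq
      card-⋃ : card (⋃ₑ seq) ≡ length seq + r
      rank-⋃ : ∀ M → IsHkMatroid (suc r) M → RankAtMost M (⋃ₑ seq) r

    support : ESet n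
    support = ⋃ₑ seq

  open Chain

  module _ {r : ℕ} where

    chain-base : ∀ {C} → IsHkSet (suc r) C → Chain r
    chain-base {C} C-Hk = record
      { seq    = C ∷ []
      ; proper = (C-Hk ∷ []) , λ { fzero () }
      ; card-⋃ = trans (card-cong C∪∅≐C) (card-Hk C-Hk)
      ; rank-⋃ = λ M M-Hk → rankAtMost-⊆ {M} {C} (λ f h → trans (sym (C∪∅≐C f)) h)
                              (rankAtMost-circuit {M} {C} (M-Hk C C-Hk) (card-Hk C-Hk))
      }
      where
      C∪∅≐C : ∀ f → (C ∪ₑ ∅ₑ) f ≡ C f
      C∪∅≐C f = ∨-identityʳ (C f)

    chain-extend : ∀ (ch : Chain r) {e} → support ch e ≡ false → Covers (suc r) (support ch) e →
                   Σ (Chain r) λ ch′ → ∀ f → support ch′ f ≡ (support ch ∪ₑ ⁅ e ⁆ₑ) f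
    chain-extend ch {e} e∉ (C , C-Hk , Ce , C⊆) = ch′ , support≐
      where
      support≐ : ∀ f → ⋃ₑ (seq ch ∷ʳ C) f ≡ (support ch ∪ₑ ⁅ e ⁆ₑ) f
      support≐ f = trans (⋃-∷ʳ (seq ch) C f) (∪-covering Ce C⊆ f)
      C⊈ : ¬ (C ⊆ₑ support ch)
      C⊈ C⊆E = contradiction (trans (sym (C⊆E e Ce)) e∉) λ ()
      ch′ : Chain r
      ch′ = record
        { seq    = seq ch ∷ʳ C
        ; proper = proper-∷ʳ (proper ch) C-Hk C⊈
        ; card-⋃ = begin
            card (⋃ₑ (seq ch ∷ʳ C))        ≡⟨ card-cong support≐ ⟩
            card (support ch ∪ₑ ⁅ e ⁆ₑ)    ≡⟨ card-∪⁅⁆ e∉ ⟩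
            suc (card (support ch))        ≡⟨ cong suc (card-⋃ ch) ⟩
            suc (length (seq ch)) + r      ≡⟨ cong (_+ r) (trans (+-comm 1 _) (sym (length-++ (seq ch)))) ⟩
            length (seq ch ∷ʳ C) + r       ∎
        ; rank-⋃ = λ M M-Hk → rankAtMost-⊆ {M} {support ch ∪ₑ ⁅ e ⁆ₑ} (λ f h → trans (sym (support≐ f)) h)
                                (rankAtMost-∪⁅⁆ {M} {C} (M-Hk C C-Hk) (card-Hk C-Hk) Ce C⊆ (rank-⋃ ch M M-Hk))
        }
        where open ≡-Reasoning

    module _ (ch : Chain r) {P : Edge n → Set} (P? : Decidable P)
             (cover : ∀ e → P e → Covers (suc r) (support ch) e) where

      absorb : ∀ x (ch₁ : Chain r) → support ch ⊆ₑ support ch₁ →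
               Σ (Chain r) λ ch₂ → support ch₁ ⊆ₑ support ch₂ × (P x → x ∈ₑ support ch₂)
      absorb x ch₁ ch⊆ch₁ with support ch₁ x in x∈? | P? x
      ... | true  | _      = ch₁ , (λ _ h → h) , λ _ → x∈?
      ... | false | no ¬Px = ch₁ , (λ _ h → h) , λ Px → contradiction Px ¬Px
      ... | false | yes Px with chain-extend ch₁ x∈? (covers-mono ch⊆ch₁ (cover x Px))
      ...   | ch₂ , ch₂≐ =
        ch₂ , (λ f h → trans (ch₂≐ f) (∨-trueˡ _ h)) , λ _ → trans (ch₂≐ x) (∨-trueʳ _ (∈⁅⁆ x))

      absorb-all : ∀ L (ch₁ : Chain r) → support ch ⊆ₑ support ch₁ →
                   Σ (Chain r) λ ch₂ → support ch₁ ⊆ₑ support ch₂ × (∀ e → e ∈ L → P e → e ∈ₑ support ch₂)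
      absorb-all []      ch₁ _       = ch₁ , (λ _ h → h) , λ _ ()
      absorb-all (x ∷ L) ch₁ ch⊆ch₁ with absorb x ch₁ ch⊆ch₁
      ... | ch₂ , ch₁⊆ch₂ , x∈ with absorb-all L ch₂ (λ f h → ch₁⊆ch₂ f (ch⊆ch₁ f h))
      ...   | ch₃ , ch₂⊆ch₃ , L∈ = ch₃ , (λ f h → ch₂⊆ch₃ f (ch₁⊆ch₂ f h)) , λ
        { e (here refl) Pe → ch₂⊆ch₃ e (x∈ Pe)
        ; e (there e∈L) Pe → L∈ e e∈L Pe }

      grow : Σ (Chain r) λ ch′ → support ch ⊆ₑ support ch′ × (∀ e → P e → e ∈ₑ support ch′)
      grow with absorb-all (allEdges n) ch (λ _ h → h)
      ... | ch′ , ch⊆ch′ , all∈ = ch′ , ch⊆ch′ , λ e → all∈ e (∈-allEdges e)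

  -- Covering K_n

  module _ {k : ℕ} where

    endpoint : Fin n → Fin n → HkVertex k → Fin n
    endpoint u v (inj₁ _) = u
    endpoint u v (inj₂ _) = v

    endpoint-injective : ∀ {u v} → u ≢ v → ∀ {x y : HkVertex k} → pairOf x ≡ pairOf y →
                         endpoint u v x ≡ endpoint u v y → x ≡ y
    endpoint-injective u≢v {inj₁ _} {inj₁ _} refl _  = refl
    endpoint-injective u≢v {inj₂ _} {inj₂ _} refl _  = refl
    endpoint-injective u≢v {inj₁ _} {inj₂ _} _    eq = contradiction eq u≢v
    endpoint-injective u≢v {inj₂ _} {inj₁ _} _    eq = contradiction (sym eq) u≢v

    pairOf-swap : ∀ (x : HkVertex k) → pairOf (swap x) ≡ pairOf x
    pairOf-swap (inj₁ _) = refl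
    pairOf-swap (inj₂ _) = refl

    swap-≢ : ∀ (x : HkVertex k) → swap x ≢ x
    swap-≢ (inj₁ _) ()
    swap-≢ (inj₂ _) ()

    endpoint-∈ : ∀ u v (x : HkVertex k) → endpoint u v x ≡ u ⊎ endpoint u v x ≡ v
    endpoint-∈ u v (inj₁ _) = inj₁ refl
    endpoint-∈ u v (inj₂ _) = inj₂ refl

    _[_↦_,_] : (HkVertex k → Fin n) → Fin k → Fin n → Fin n → HkVertex k → Fin n
    (φ [ p ↦ u , v ]) x with pairOf x ≟ᶠ p
    ... | yes _ = endpoint u v x
    ... | no  _ = φ x

    module _ (φ : HkVertex k → Fin n) (p : Fin k) (u v : Fin n) where

      update-on : ∀ x → pairOf x ≡ p → (φ [ p ↦ u , v ]) x ≡ endpoint u v x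
      update-on x x∈p with pairOf x ≟ᶠ p
      ... | yes _   = refl
      ... | no  x∉p = contradiction x∈p x∉p

      update-off : ∀ x → pairOf x ≢ p → (φ [ p ↦ u , v ]) x ≡ φ x
      update-off x x∉p with pairOf x ≟ᶠ p
      ... | yes x∈p = contradiction x∈p x∉p
      ... | no  _   = refl

    -- Vacuous when z is not a vertex of φ.
    Near : (HkVertex k → Fin n) → Fin k → Fin n → Set
    Near φ p z = ∀ x → φ x ≡ z → pairOf x ≡ p

    update-preimage : ∀ {φ p u v z q} → Near φ q z → z ≢ u → z ≢ v →
                      ∀ x → (φ [ p ↦ u , v ]) x ≡ z → pairOf x ≡ q × pairOf x ≢ p
    update-preimage {φ} {p} {u} {v} near-z z≢u z≢v x φ′x≡z with pairOf x ≟ᶠ p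
    ... | no  x∉p = near-z x φ′x≡z , x∉p
    ... | yes _ with endpoint-∈ u v x
    ...   | inj₁ ≡u = contradiction (trans (sym φ′x≡z) ≡u) z≢u
    ...   | inj₂ ≡v = contradiction (trans (sym φ′x≡z) ≡v) z≢v

    module _ {φ : HkVertex k → Fin n} {p : Fin k} {u v : Fin n} (near-u : Near φ p u) (near-v : Near φ p v) where

      near-endpoint : ∀ x y → φ y ≡ endpoint u v x → pairOf y ≡ p
      near-endpoint x y φy≡ with endpoint-∈ u v x
      ... | inj₁ ≡u = near-u y (trans φy≡ ≡u)
      ... | inj₂ ≡v = near-v y (trans φy≡ ≡v)

      update-injective : Injective _≡_ _≡_ φ → u ≢ v → Injective _≡_ _≡_ (φ [ p ↦ u , v ])
      update-injective φ-inj u≢v {x} {y} eq with pairOf x ≟ᶠ p | pairOf y ≟ᶠ p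
      ... | yes x∈p | yes y∈p = endpoint-injective u≢v (trans x∈p (sym y∈p)) eq
      ... | yes _   | no  y∉p = contradiction (near-endpoint x y (sym eq)) y∉p
      ... | no  x∉p | yes _   = contradiction (near-endpoint y x eq) x∉p
      ... | no  _   | no  _   = φ-inj eq

    covers-update : ∀ {φ : HkVertex k → Fin n} {p u v E e} → Injective _≡_ _≡_ φ → u ≢ v →
                    Near φ p u → Near φ p v → Ends e u v →
                    (∀ l → l ≢ p → ∀ g → PairEdge φ l g → g ∈ₑ E) → Covers k E e
    covers-update {φ} {p} {u} {v} {E} {e} φ-inj u≢v near-u near-v e-ends others =
      matching φ′ φ′-inj , matching-isHk φ′ φ′-inj , e∈ , C⊆
      where
      φ′ : HkVertex k → Fin n
      φ′ = φ [ p ↦ u , v ]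
      φ′-inj : Injective _≡_ _≡_ φ′
      φ′-inj = update-injective near-u near-v φ-inj u≢v
      on-p : ∀ g → Ends g u v → PairEdge φ′ p g
      on-p g = subst₂ (Ends g) (sym (update-on φ p u v (inj₁ p) refl)) (sym (update-on φ p u v (inj₂ p) refl))
      at-p : ∀ g → PairEdge φ′ p g → Ends g u v
      at-p g = subst₂ (Ends g) (update-on φ p u v (inj₁ p) refl) (update-on φ p u v (inj₂ p) refl)
      off-p : ∀ g l → l ≢ p → PairEdge φ′ l g → PairEdge φ l g
      off-p g l l≢p = subst₂ (Ends g) (update-off φ p u v (inj₁ l) l≢p) (update-off φ p u v (inj₂ l) l≢p)
      e∈ : e ∈ₑ matching φ′ φ′-inj
      e∈ = Equivalence.from (matching-∈ φ′ φ′-inj e) (p , on-p e e-ends)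
      sort : ∀ g l → Dec (l ≡ p) → PairEdge φ′ l g → g ∈ₑ (E ∪ₑ ⁅ e ⁆ₑ)
      sort g l (yes refl) g-ends = ∨-trueʳ _ (≡⇒∈⁅⁆ {g} {e} (Ends-unique (at-p g g-ends) e-ends))
      sort g l (no  l≢p)  g-ends = ∨-trueˡ _ (others l l≢p g (off-p g l l≢p g-ends))
      C⊆ : matching φ′ φ′-inj ⊆ₑ (E ∪ₑ ⁅ e ⁆ₑ)
      C⊆ g g∈ with Equivalence.to (matching-∈ φ′ φ′-inj g) g∈
      ... | l , g-ends = sort g l (l ≟ᶠ p) g-ends

  module _ {r : ℕ} (φ₀ : HkVertex (suc r) → Fin n) (φ₀-inj : Injective _≡_ _≡_ φ₀)
           (w : Fin n) (w-free : ∀ x → φ₀ x ≢ w) where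

    near-self : ∀ x → Near φ₀ (pairOf x) (φ₀ x)
    near-self x y eq = cong pairOf (φ₀-inj eq)

    near-free : ∀ {z} → (∀ x → φ₀ x ≢ z) → ∀ p → Near φ₀ p z
    near-free z-free p x eq = contradiction eq (z-free x)

    locate : ∀ z → (∃ λ x → φ₀ x ≡ z) ⊎ (∀ x → φ₀ x ≢ z)
    locate z with Finₚ.any? (λ l → φ₀ (inj₁ l) ≟ᶠ z) | Finₚ.any? (λ l → φ₀ (inj₂ l) ≟ᶠ z)
    ... | yes (l , eq) | _            = inj₁ (inj₁ l , eq)
    ... | no  _        | yes (l , eq) = inj₁ (inj₂ l , eq)
    ... | no  none₁    | no  none₂    = inj₂ λ { (inj₁ l) eq → none₁ (l , eq) ; (inj₂ l) eq → none₂ (l , eq) }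

    Local : Edge n → Set
    Local ((u , v) , _) = Σ (Fin (suc r)) λ p → Near φ₀ p u × Near φ₀ p v

    Cross : Edge n → Set
    Cross ((u , v) , _) = Σ (HkVertex (suc r)) λ s → Σ (HkVertex (suc r)) λ t →
                            φ₀ s ≡ u × φ₀ t ≡ v × pairOf s ≢ pairOf t

    classify : ∀ e → Local e ⊎ Cross e
    classify ((u , v) , _) with locate u | locate v
    ... | inj₁ (s , refl) | inj₁ (t , refl) with pairOf s ≟ᶠ pairOf t
    ...   | yes s~t = inj₁ (pairOf s , near-self s , subst (λ p → Near φ₀ p (φ₀ t)) (sym s~t) (near-self t))
    ...   | no  s≁t = inj₂ (s , t , refl , refl , s≁t)
    classify _ | inj₁ (s , refl) | inj₂ v-free    = inj₁ (pairOf s , near-self s , near-free v-free _)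
    classify _ | inj₂ u-free    | inj₁ (t , refl) = inj₁ (pairOf t , near-free u-free _ , near-self t)
    classify _ | inj₂ u-free    | inj₂ v-free    = inj₁ (fzero , near-free u-free _ , near-free v-free _)

    cross⇒¬local : ∀ {e} → Cross e → ¬ Local e
    cross⇒¬local {(_ , _) , _} (s , t , refl , refl , s≁t) (p , near-u , near-v) =
      s≁t (trans (near-u s refl) (sym (near-v t refl)))

    local? : Decidable Local
    local? e with classify e
    ... | inj₁ le = yes le
    ... | inj₂ ce = no (cross⇒¬local {e} ce)

    cross? : Decidable Cross
    cross? e with classify e
    ... | inj₁ le = no λ ce → cross⇒¬local {e} ce le
    ... | inj₂ ce = yes ce

    local-ends : ∀ {g a b p} → Ends g a b → Near φ₀ p a → Near φ₀ p b → Local g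
    local-ends {(_ , _) , _} (inj₁ (refl , refl)) near-a near-b = _ , near-a , near-b
    local-ends {(_ , _) , _} (inj₂ (refl , refl)) near-a near-b = _ , near-b , near-a

    cover-local : ∀ {e} → Local e → Covers (suc r) (matching φ₀ φ₀-inj) e
    cover-local {(u , v) , u<v} (p , near-u , near-v) =
      covers-update φ₀-inj (Finₚ.<⇒≢ u<v) near-u near-v (inj₁ (refl , refl))
                    (λ l _ g g-ends → Equivalence.from (matching-∈ φ₀ φ₀-inj g) (l , g-ends))

    -- The covering copy is φ₀ with the edge through s replaced by the local edge from the partner
    -- of s to w, and then the edge through t replaced by uv.
    cover-cross : ∀ {E e} → (∀ g → Local g → g ∈ₑ E) → Cross e → Covers (suc r) E e
    cover-cross {E} {(_ , _) , u<v} local⊆E (s , t , refl , refl , i≢j) =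
      covers-update φ₁-inj (Finₚ.<⇒≢ u<v) near-u near-v (inj₁ (refl , refl)) others
      where
      i : Fin (suc r)
      i = pairOf s
      a : Fin n
      a = φ₀ (swap s)
      near-a : Near φ₀ i a
      near-a = subst (λ q → Near φ₀ q a) (pairOf-swap s) (near-self (swap s))
      φ₁ : HkVertex (suc r) → Fin n
      φ₁ = φ₀ [ i ↦ a , w ]
      φ₁-inj : Injective _≡_ _≡_ φ₁
      φ₁-inj = update-injective near-a (near-free w-free i) φ₀-inj (w-free (swap s))
      near-u : Near φ₁ (pairOf t) (φ₀ s)
      near-u x φ₁x≡u =
        let x∈i , x∉i = update-preimage {φ = φ₀} {i} {a} {w} (near-self s) u≢a (w-free s) x φ₁x≡u in contradiction x∈i x∉i
        where
        u≢a : φ₀ s ≢ a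
        u≢a eq = swap-≢ s (sym (φ₀-inj eq))
      near-v : Near φ₁ (pairOf t) (φ₀ t)
      near-v x φ₁x≡v = proj₁ (update-preimage {φ = φ₀} {i} {a} {w} (near-self t) v≢a (w-free t) x φ₁x≡v)
        where
        v≢a : φ₀ t ≢ a
        v≢a eq = i≢j (sym (trans (cong pairOf (φ₀-inj eq)) (pairOf-swap s)))
      near-endpoint₁ : ∀ x → Near φ₀ i (endpoint a w x)
      near-endpoint₁ (inj₁ _) = near-a
      near-endpoint₁ (inj₂ _) = near-free w-free i
      near₁ : ∀ x → Near φ₀ (pairOf x) (φ₁ x)
      near₁ x with pairOf x ≟ᶠ i
      ... | yes x∈i = subst (λ q → Near φ₀ q (endpoint a w x)) (sym x∈i) (near-endpoint₁ x)
      ... | no  _   = near-self x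
      others : ∀ l → l ≢ pairOf t → ∀ g → PairEdge φ₁ l g → g ∈ₑ E
      others l _ g g-ends = local⊆E g (local-ends {g} g-ends (near₁ (inj₁ l)) (near₁ (inj₂ l)))

    spanning-chain : Σ (Chain r) λ ch → ∀ e → e ∈ₑ support ch
    spanning-chain with grow (chain-base (matching-isHk φ₀ φ₀-inj)) local?
                              (λ e le → covers-mono (λ f h → ∨-trueˡ false h) (cover-local le))
    ... | ch₁ , _ , local∈ch₁ with grow ch₁ cross? (λ e ce → cover-cross local∈ch₁ ce)
    ...   | ch₂ , ch₁⊆ch₂ , cross∈ch₂ =
      ch₂ , λ e → [ (λ le → ch₁⊆ch₂ e (local∈ch₁ e le)) , cross∈ch₂ e ]′ (classify e)

  module _ {r : ℕ} (ch : Chain r) (spans : ∀ e → e ∈ₑ support ch) where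

    spanning⇒maximal : ∀ M → IsHkMatroid (suc r) M → M ⪯ uniform r
    spanning⇒maximal M M-Hk X X-indep = rank-⋃ ch M M-Hk X (λ e _ → spans e) X-indep

    spanning⇒valH : ∀ F → IsValH (suc r) F (card F ⊓ r)
    spanning⇒valH F = witness , lower
      where
      F∪∅≐F : ∀ f → (F ∪ₑ ⋃ₑ []) f ≡ F f
      F∪∅≐F f = ∨-identityʳ (F f)
      F∪S≐S : ∀ f → (F ∪ₑ support ch) f ≡ support ch f
      F∪S≐S f = trans (∨-trueʳ (F f) (spans f)) (sym (spans f))
      witness : Σ (List (ESet n)) λ S → ProperSeq (suc r) S × val F S ≡ card F ⊓ r
      witness with card F ≤? r
      ... | yes F≤r = [] , ([] , λ ()) , trans (card-cong F∪∅≐F) (sym (m≤n⇒m⊓n≡m F≤r))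
      ... | no  F≰r = seq ch , proper ch , (begin
        card (F ∪ₑ support ch) ∸ length (seq ch) ≡⟨ cong (_∸ length (seq ch)) (card-cong F∪S≐S) ⟩
        card (support ch) ∸ length (seq ch)      ≡⟨ cong (_∸ length (seq ch)) (card-⋃ ch) ⟩
        (length (seq ch) + r) ∸ length (seq ch)  ≡⟨ m+n∸m≡n (length (seq ch)) r ⟩
        r                                        ≡⟨ sym (m≥n⇒m⊓n≡n (<⇒≤ (≰⇒> F≰r))) ⟩
        card F ⊓ r                               ∎)
        where open ≡-Reasoning
      lower : ∀ S → ProperSeq (suc r) S → card F ⊓ r ≤ val F S
      lower []      _  = ≤-trans (m⊓n≤m (card F) r) (≤-reflexive (sym (card-cong F∪∅≐F)))
      lower (X ∷ S) pS = ≤-trans (m⊓n≤n (card F) r) (val-proper {F = F} pS)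

base-copy : ∀ {k n} → 2 * k + 1 ≤ n →
            Σ (HkVertex k → Fin n) λ φ → Injective _≡_ _≡_ φ × Σ (Fin n) λ w → ∀ x → φ x ≢ w
base-copy {k} {n} 2k+1≤n = φ , φ-inj , w , w-free
  where
  2k<n : k + k < n
  2k<n = subst (_≤ n) (trans (+-comm (2 * k) 1) (cong (λ m → suc (k + m)) (+-identityʳ k))) 2k+1≤n
  φ : HkVertex k → Fin n
  φ x = inject≤ (join k k x) (<⇒≤ 2k<n)
  φ-inj : Injective _≡_ _≡_ φ
  φ-inj {x} {y} eq = begin
    x                         ≡⟨ splitAt-join k k x ⟨
    splitAt k (join k k x)    ≡⟨ cong (splitAt k) (inject≤-injective _ _ _ _ eq) ⟩
    splitAt k (join k k y)    ≡⟨ splitAt-join k k y ⟩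
    y                         ∎
    where open ≡-Reasoning
  w : Fin n
  w = fromℕ< 2k<n
  w-free : ∀ x → φ x ≢ w
  w-free x eq = <-irrefl (trans (sym (toℕ-inject≤ (join k k x) _)) (trans (cong toℕ eq) (toℕ-fromℕ< 2k<n)))
                         (toℕ<n (join k k x))

theorem3p4 : (k : ℕ) → 1 ≤ k → (n : ℕ) → 2 * k + 1 ≤ n →
    Σ (Matroid n) λ U →
      (∀ X → Indep U X ⇔ card X ≤ k ∸ 1) ×
      IsHkMatroid k U ×
      (∀ M → IsHkMatroid k M → M ⪯ U) ×
      (∀ F → Σ ℕ λ r → IsRank U F r × IsValH k F r)
theorem3p4 (suc r) _ n 2k+1≤n with base-copy 2k+1≤n
... | φ₀ , φ₀-inj , w , w-free with spanning-chain φ₀ φ₀-inj w w-free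
...   | ch , spans =
  uniform r , (λ X → mk⇔ id id) , uniform-isHk , spanning⇒maximal ch spans ,
  λ F → card F ⊓ r , uniform-rank F , spanning⇒valH ch spans F
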